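{- For each integer $t \ge 3$ and all sufficiently large $n \in \mathbb{N}$, there is a two-colouring of the edges of $K_n$ that does not contain an unavoidable $t$-colouring and that is $\delta_t(n)$-far from being monochromatic, where $\delta_t(n) = (\mathrm{ex}(n, K_{t,t}) - 1)/(2n^2)$.
   Context: $\mathrm{ex}(n, H)$ denotes the Turán number: the maximum number of edges in an $n$-vertex graph with no subgraph isomorphic to $H$; $K_{t,t}$ is the complete bipartite graph with both parts of size $t$. A two-colouring (red/blue) of the edges of $K_n$ is $\delta$-far from being monochromatic if each colour appears on at least $\delta n^2$ edges. An unavoidable $t$-colouring is a two-colouring of the edges of $K_{2t}$ in which the edges of one colour form either a clique on $t$ vertices or two vertex-disjoint cliques on $t$ vertices each, all remaining edges having the other colour; a colouring of $K_n$ contains one if some set of $2t$ vertices induces such a colouring. -}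

module Defs where

open import Data.Nat as ℕ using (ℕ; zero; suc; _<ᵇ_; NonZero)
open import Data.Nat.Properties using (m*n≢0)
open import Data.Bool using (Bool; true; false; not; _∧_; _xor_; if_then_else_)
open import Data.Fin using (Fin; toℕ)
open import Data.List using (List; map; allFin; concatMap)
open import Data.Nat.ListAction using (sum)
open import Data.Sum using (_⊎_; inj₁; inj₂)
open import Data.Product using (Σ; ∃; ∃-syntax; _×_; _,_)
open import Data.Integer as ℤ using (ℤ; +_)
open import Data.Rational as ℚ using (ℚ)
open import Function.Definitions using (Injective)
open import Relation.Binary.PropositionalEquality using (_≡_; _≢_)
open import Relation.Nullary using (¬_)

_==_ : Bool → Bool → Bool
a == b = not (a xor b)

infix 4 _==_

-- A two-colouring of the edges of K_n (equivalently, a simple graph on n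
-- vertices): a symmetric Bool-valued function on pairs of vertices.
-- Only values on pairs of distinct vertices are meaningful.
-- For colourings, true = red, false = blue.
record Colouring (n : ℕ) : Set where
  field
    col : Fin n → Fin n → Bool
    sym : ∀ i j → col i j ≡ col j i
open Colouring public

Graph : ℕ → Set
Graph = Colouring

countColour : ∀ {n} → Colouring n → Bool → ℕ
countColour {n} c χ =
  sum (concatMap (λ i → map (λ j →
         if (toℕ i <ᵇ toℕ j) ∧ (col c i j == χ) then 1 else 0) (allFin n))
       (allFin n))

edges : ∀ {n} → Graph n → ℕ
edges G = countColour G true

-- Vertices of K_{t,t}: left part Fin t, right part Fin t.
-- G contains a subgraph isomorphic to K_{t,t}: an injective map of the
-- 2t vertices sending every left-right pair to an edge.
ContainsKtt : ∀ {n} → ℕ → Graph n → Set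
ContainsKtt {n} t G =
  Σ (Fin t ⊎ Fin t → Fin n) λ f → Injective _≡_ _≡_ f ×
    (∀ a b → col G (f (inj₁ a)) (f (inj₂ b)) ≡ true)

IsExKtt : ℕ → ℕ → ℕ → Set
IsExKtt n t m =
  (Σ (Graph n) λ G → ¬ ContainsKtt t G × edges G ≡ m) ×
  (∀ (G : Graph n) → ¬ ContainsKtt t G → edges G ℕ.≤ m)

isLeft : ∀ {t} → Fin t ⊎ Fin t → Bool
isLeft (inj₁ _) = true
isLeft (inj₂ _) = false

-- The 2t vertices are labelled Fin t ⊎ Fin t; the cliques are the left part
-- (one-clique case) or the left and right parts (two-clique case).
oneClique : ∀ {t} → Bool → Fin t ⊎ Fin t → Fin t ⊎ Fin t → Bool
oneClique χ x y = if isLeft x ∧ isLeft y then χ else not χ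

twoCliques : ∀ {t} → Bool → Fin t ⊎ Fin t → Fin t ⊎ Fin t → Bool
twoCliques χ x y = if isLeft x == isLeft y then χ else not χ

InducesPattern : ∀ {n t} → Colouring n →
                 (Fin t ⊎ Fin t → Fin t ⊎ Fin t → Bool) → Set
InducesPattern {n} {t} c P =
  Σ (Fin t ⊎ Fin t → Fin n) λ g → Injective _≡_ _≡_ g ×
    (∀ x y → x ≢ y → col c (g x) (g y) ≡ P x y)

ContainsUnavoidable : ∀ {n} → ℕ → Colouring n → Set
ContainsUnavoidable t c =
  ∃[ χ ] (InducesPattern {t = t} c (oneClique χ) ⊎
          InducesPattern {t = t} c (twoCliques χ))

FarFromMonochromatic : ∀ {n} → ℚ → Colouring n → Set
FarFromMonochromatic {n} δ c =
  ∀ χ → δ ℚ.* ((+ (n ℕ.* n)) ℚ./ 1) ℚ.≤ ((+ countColour c χ) ℚ./ 1)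

deltaEx : (n m : ℕ) → .{{NonZero n}} → ℚ
deltaEx n m = ((+ m) ℤ.- (+ 1)) ℚ./ (2 ℕ.* (n ℕ.* n))
  where instance
    _ : NonZero (2 ℕ.* (n ℕ.* n))
    _ = m*n≢0 2 (n ℕ.* n) {{_}} {{m*n≢0 n n}}

module Submission where

-- Let G be an extremal K_{t,t}-free graph on n vertices, with m = ex(n,K_{t,t})
-- edges.  Every graph has a bipartition s of its vertices such that at least
-- half of its edges cross it (greedy max-cut), and from these crossing edges
-- we may keep exactly ⌊m/2⌋.  Colour the kept edges red and every other pair
-- blue.  The red graph is bipartite, so it has no triangle; every unavoidable
-- t-colouring except "two blue t-cliques" contains a red t-clique (t ≥ 3),
-- and two blue t-cliques force a red, hence G-, copy of K_{t,t}.  Finally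
-- red = ⌊m/2⌋ ≥ (m-1)/2 and blue ≥ m - ⌊m/2⌋ ≥ m/2, which is δ_t(n)·n².
-- The construction works for every n ≥ 1, so N = 0 suffices.

open import Defs
open import Data.Nat using (ℕ; _≤_; NonZero)
open import Data.Product using (Σ; ∃; _×_)
open import Relation.Nullary using (¬_)

open import Data.Nat as ℕ using (zero; suc; _+_; _*_; _∸_; _<ᵇ_; ⌊_/2⌋; z≤n; s≤s)
open import Data.Nat.Properties
  using ( +-0-commutativeMonoid; +-identityʳ; +-suc; +-mono-≤; +-monoˡ-≤
        ; +-monoʳ-≤; +-cancelˡ-≤; *-monoʳ-≤; *-distribˡ-+; m≤m+n; m≤n⇒m≤1+n
        ; ≤-total; _≤?_; ≰⇒>; <⇒≤; m≤n+o⇒m∸n≤o; m∸n+n≡m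
        ; module ≤-Reasoning )
import Data.Nat.Properties as ℕP
open import Data.Bool using (Bool; true; false; _∧_; _∨_; _xor_; if_then_else_)
open import Data.Bool.Properties using (∨-comm; xor-comm; ∧-conicalˡ; ∧-conicalʳ)
open import Data.Fin using (Fin; toℕ; zero; suc)
open import Data.Fin.Patterns using (0F; 1F; 2F)
open import Data.Vec.Functional using (Vector; _∷_)
open import Data.List as List using (List; []; map; allFin; concatMap; tabulate)
open import Data.Nat.ListAction using () renaming (sum to listSum)
open import Data.Nat.ListAction.Properties using (sum-++)
open import Algebra.Properties.CommutativeMonoid.Sum +-0-commutativeMonoid
  using (sum; sum-cong-≗; ∑-distrib-+; sum-replicate-zero)
open import Data.Product using (_,_)
open import Data.Sum using (_⊎_; inj₁; inj₂)
open import Data.Empty using (⊥)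
open import Function using (_∘_; id; const)
open import Relation.Binary.PropositionalEquality
  using (_≡_; _≢_; refl; trans; cong; cong₂; subst; module ≡-Reasoning)
import Relation.Binary.PropositionalEquality as Eq
open import Relation.Nullary using (yes; no)
open import Data.Integer as ℤ using (ℤ) renaming (+_ to ⁺_)
import Data.Integer.Properties as ℤP
open import Data.Rational as ℚ using (toℚᵘ)
open import Data.Rational.Properties using (toℚᵘ-cancel-≤; toℚᵘ-homo-*; toℚᵘ-fromℚᵘ)
open import Data.Rational.Unnormalised as ℚᵘ using (mkℚᵘ; *≤*)
open import Data.Rational.Unnormalised.Properties
  using (≤-respˡ-≃; ≤-respʳ-≃; ≃-sym; ≃-trans; *-cong)

𝟙 : Bool → ℕ
𝟙 b = if b then 1 else 0

count : ∀ {n} → Vector Bool n → ℕ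
count f = sum (𝟙 ∘ f)

Matrix : ℕ → ℕ → Set
Matrix r c = Fin r → Fin c → Bool

count² : ∀ {r c} → Matrix r c → ℕ
count² W = sum (count ∘ W)

_∩_ : ∀ {r c} → Matrix r c → Matrix r c → Matrix r c
(U ∩ V) i j = U i j ∧ V i j

-- The strictly upper-triangular part of a square matrix: the pairs i < j.
-- A graph (or colour class) on Fin n is counted as count² ∘ upper.
upper : ∀ {n} → Matrix n n → Matrix n n
upper U i j = (toℕ i <ᵇ toℕ j) ∧ U i j

sum-map-tabulate : ∀ {A : Set} {n} (f : A → ℕ) (g : Fin n → A) →
                   listSum (map f (tabulate g)) ≡ sum (f ∘ g)
sum-map-tabulate {n = zero}  f g = refl
sum-map-tabulate {n = suc n} f g = cong (f (g zero) +_) (sum-map-tabulate f (g ∘ suc))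

sum-concatMap : ∀ {A : Set} (g : A → List ℕ) (xs : List A) →
                listSum (concatMap g xs) ≡ listSum (map (listSum ∘ g) xs)
sum-concatMap g []       = refl
sum-concatMap g (x List.∷ xs) =
  trans (sum-++ (g x) (concatMap g xs)) (cong (listSum (g x) +_) (sum-concatMap g xs))

countColour-count² : ∀ {n} (c : Colouring n) χ →
                     countColour c χ ≡ count² (upper (λ i j → col c i j == χ))
countColour-count² {n} c χ =
  trans (sum-concatMap row (allFin n))
    (trans (sum-map-tabulate (listSum ∘ row) id)
      (sum-cong-≗ λ i → sum-map-tabulate (𝟙 ∘ upper (λ i j → col c i j == χ) i) id))
  where
  row : Fin n → List ℕ
  row i = map (𝟙 ∘ upper (λ i j → col c i j == χ) i) (allFin n)

edges-count² : ∀ {n} (G : Graph n) → edges G ≡ count² (upper (col G))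
edges-count² G =
  trans (countColour-count² G true)
    (sum-cong-≗ λ i → sum-cong-≗ λ j →
      cong (λ b → 𝟙 ((toℕ i <ᵇ toℕ j) ∧ b)) (==-true (col G i j)))
  where
  ==-true : ∀ b → (b == true) ≡ b
  ==-true true  = refl
  ==-true false = refl

colour-classes-partition : ∀ {n} (c : Colouring n) →
  countColour c true + countColour c false ≡ count² (upper {n} (λ _ _ → true))
colour-classes-partition {n} c = begin
  countColour c true + countColour c false
    ≡⟨ cong₂ _+_ (countColour-count² c true) (countColour-count² c false) ⟩
  count² red + count² blue
    ≡⟨ Eq.sym (∑-distrib-+ (count ∘ red) (count ∘ blue)) ⟩
  sum (λ i → count (red i) + count (blue i))
    ≡⟨ sum-cong-≗ (λ i → Eq.sym (∑-distrib-+ (𝟙 ∘ red i) (𝟙 ∘ blue i))) ⟩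
  sum (λ i → sum (λ j → 𝟙 (red i j) + 𝟙 (blue i j)))
    ≡⟨ sum-cong-≗ (λ i → sum-cong-≗ λ j → one-colour (toℕ i <ᵇ toℕ j) (col c i j)) ⟩
  count² (upper {n} (λ _ _ → true)) ∎
  where
  open ≡-Reasoning
  red blue : Matrix n n
  red  = upper (λ i j → col c i j == true)
  blue = upper (λ i j → col c i j == false)
  one-colour : ∀ a b → 𝟙 (a ∧ (b == true)) + 𝟙 (a ∧ (b == false)) ≡ 𝟙 (a ∧ true)
  one-colour true  true  = refl
  one-colour true  false = refl
  one-colour false b     = refl

Cut : ∀ {n} → Vector Bool n → Matrix n n
Cut s i j = s i xor s j

-- Doubling, in the form in which 2 * x unfolds.
x+x≡2x : ∀ x → x + x ≡ 2 * x
x+x≡2x x = cong (x +_) (Eq.sym (+-identityʳ x))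

larger-half : (X : Bool → ℕ) → Σ Bool λ b → X true + X false ≤ 2 * X b
larger-half X with ≤-total (X true) (X false)
... | inj₁ t≤f = false , ℕP.≤-trans (+-monoˡ-≤ (X false) t≤f) (ℕP.≤-reflexive (x+x≡2x (X false)))
... | inj₂ f≤t = true  , ℕP.≤-trans (+-monoʳ-≤ (X true) f≤t) (ℕP.≤-reflexive (x+x≡2x (X true)))

-- Greedy max-cut: place vertex 0 on the side opposite to the majority of its
-- neighbours among the (already bipartitioned) vertices 1, …, n.
-- The edges are the pairs i < j with U i j; U need not be symmetric.
large-cut : ∀ n (U : Matrix n n) →
            Σ (Vector Bool n) λ s → count² (upper U) ≤ 2 * count² (upper (U ∩ Cut s))
large-cut zero    U = (λ ()) , z≤n
large-cut (suc n) U with large-cut n (λ i j → U (suc i) (suc j))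
... | s , rest-cut with larger-half (λ b → count (λ j → U zero (suc j) ∧ (b xor s j)))
... | b , majority = b ∷ s , (begin
  -- Vertex 0 precedes all others, so row 0 of upper U is its whole row.
  count² (upper U)
    ≡⟨⟩
  degree + count² (upper U')
    ≤⟨ +-mono-≤ (subst (_≤ 2 * crossing b) splits majority) rest-cut ⟩
  2 * crossing b + 2 * count² (upper (U' ∩ Cut s))
    ≡⟨ Eq.sym (*-distribˡ-+ 2 (crossing b) _) ⟩
  2 * count² (upper (U ∩ Cut (b ∷ s))) ∎)
  where
  open ≤-Reasoning
  U' : Matrix n n
  U' i j = U (suc i) (suc j)
  crossing : Bool → ℕ
  crossing b = count (λ j → U zero (suc j) ∧ (b xor s j))
  degree : ℕ
  degree = count (U zero ∘ suc)
  one-side : ∀ u x → 𝟙 (u ∧ (true xor x)) + 𝟙 (u ∧ (false xor x)) ≡ 𝟙 u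
  one-side true  true  = refl
  one-side true  false = refl
  one-side false x     = refl
  splits : crossing true + crossing false ≡ degree
  splits = trans (Eq.sym (∑-distrib-+ (λ j → 𝟙 (U zero (suc j) ∧ (true xor s j)))
                                      (λ j → 𝟙 (U zero (suc j) ∧ (false xor s j)))))
                 (sum-cong-≗ λ j → one-side (U zero (suc j)) (s j))

_⊆_ : ∀ {A : Set} → (A → Bool) → (A → Bool) → Set
g ⊆ f = ∀ a → g a ≡ true → f a ≡ true

_⊆²_ : ∀ {r c} → Matrix r c → Matrix r c → Set
V ⊆² W = ∀ i → V i ⊆ W i

∷-⊆ : ∀ {n} {b} {g : Vector Bool n} {f : Vector Bool (suc n)} →
      (b ≡ true → f zero ≡ true) → g ⊆ (f ∘ suc) → (b ∷ g) ⊆ f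
∷-⊆ head tail zero    = head
∷-⊆ head tail (suc j) = tail j

∷-⊆² : ∀ {r c} {g : Vector Bool c} {V : Matrix r c} {W : Matrix (suc r) c} →
       g ⊆ W zero → V ⊆² (W ∘ suc) → (g ∷ V) ⊆² W
∷-⊆² head tail zero    = head
∷-⊆² head tail (suc i) = tail i

trim-vector : ∀ {n} (f : Vector Bool n) k → k ≤ count f →
              Σ (Vector Bool n) λ g → g ⊆ f × count g ≡ k
trim-vector {zero} f zero _ = f , (λ _ e → e) , refl
trim-vector {suc n} f k k≤ with f zero in f₀
trim-vector {suc n} f k k≤ | false with trim-vector (f ∘ suc) k k≤
... | g , g⊆ , #g = false ∷ g , ∷-⊆ (λ ()) g⊆ , #g
trim-vector {suc n} f zero _ | true with trim-vector (f ∘ suc) zero z≤n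
... | g , g⊆ , #g = false ∷ g , ∷-⊆ (λ ()) g⊆ , #g
trim-vector {suc n} f (suc k) (s≤s k≤) | true with trim-vector (f ∘ suc) k k≤
... | g , g⊆ , #g = true ∷ g , ∷-⊆ (λ _ → f₀) g⊆ , cong suc #g

-- A matrix with at least k true entries has a sub-matrix with exactly k:
-- either the rows 1, … already suffice, or keep them and trim row 0.
trim-matrix : ∀ {r c} (W : Matrix r c) k → k ≤ count² W →
              Σ (Matrix r c) λ V → V ⊆² W × count² V ≡ k
trim-matrix {zero} W zero _ = W , (λ ()) , refl
trim-matrix {suc r} {c} W k k≤ with k ≤? count² (W ∘ suc)
... | yes k≤rest =
  let V , V⊆ , #V = trim-matrix (W ∘ suc) k k≤rest
  in const false ∷ V , ∷-⊆² (λ _ ()) V⊆ , trans (cong (_+ count² V) (sum-replicate-zero c)) #V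
... | no k≰rest =
  let rest = count² (W ∘ suc)
      row-fits = m≤n+o⇒m∸n≤o k rest (subst (k ≤_) (ℕP.+-comm _ rest) k≤)
      g , g⊆ , #g = trim-vector (W zero) (k ∸ rest) row-fits
  in g ∷ (W ∘ suc) , ∷-⊆² g⊆ (λ _ _ e → e)
     , trans (cong (_+ rest) #g) (m∸n+n≡m (<⇒≤ (≰⇒> k≰rest)))

selection-colouring : ∀ {n} → Matrix n n → Colouring n
selection-colouring V = record
  { col = λ i j → upper V i j ∨ upper V j i
  ; sym = λ i j → ∨-comm (upper V i j) (upper V j i)
  }

selection-red-⊆ : ∀ {n} (V W : Matrix n n) → V ⊆² upper W → (∀ i j → W i j ≡ W j i) →
                  ∀ i j → col (selection-colouring V) i j ≡ true → W i j ≡ true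
selection-red-⊆ V W V⊆ W-sym i j red with upper V i j in Vij | upper V j i in Vji
... | true | _    = ∧-conicalʳ _ _ (V⊆ i j (∧-conicalʳ _ _ Vij))
... | false | true = trans (W-sym i j) (∧-conicalʳ _ _ (V⊆ j i (∧-conicalʳ _ _ Vji)))

selection-red-count : ∀ {n} (V W : Matrix n n) → V ⊆² upper W →
                      countColour (selection-colouring V) true ≡ count² V
selection-red-count V W V⊆ =
  trans (countColour-count² (selection-colouring V) true)
    (sum-cong-≗ λ i → sum-cong-≗ λ j →
      red-entry (toℕ i <ᵇ toℕ j) (toℕ j <ᵇ toℕ i) (V i j) (V j i)
                (λ v → ∧-conicalˡ _ _ (V⊆ i j v)) (<ᵇ-asym (toℕ i) (toℕ j)))
  where
  <ᵇ-asym : ∀ a b → (a <ᵇ b) ≡ true → (b <ᵇ a) ≡ false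
  <ᵇ-asym zero    (suc b) _  = refl
  <ᵇ-asym (suc a) (suc b) lt = <ᵇ-asym a b lt
  red-entry : ∀ a a' v v' → (v ≡ true → a ≡ true) → (a ≡ true → a' ≡ false) →
              𝟙 (a ∧ ((a ∧ v ∨ a' ∧ v') == true)) ≡ 𝟙 v
  red-entry true  a' true  v' _ _ = refl
  red-entry true  a' false v' _ a→¬a' rewrite a→¬a' refl = refl
  red-entry false a' true  v' v→a _ with () ← v→a refl
  red-entry false a' false v' _ _ = refl

2⌊m/2⌋≤m : ∀ m → 2 * ⌊ m /2⌋ ≤ m
2⌊m/2⌋≤m zero          = z≤n
2⌊m/2⌋≤m (suc zero)    = z≤n
2⌊m/2⌋≤m (suc (suc m)) rewrite +-suc ⌊ m /2⌋ (⌊ m /2⌋ + 0) = s≤s (s≤s (2⌊m/2⌋≤m m))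

m≤1+2⌊m/2⌋ : ∀ m → m ≤ suc (2 * ⌊ m /2⌋)
m≤1+2⌊m/2⌋ zero          = z≤n
m≤1+2⌊m/2⌋ (suc zero)    = s≤s z≤n
m≤1+2⌊m/2⌋ (suc (suc m)) rewrite +-suc ⌊ m /2⌋ (⌊ m /2⌋ + 0) = s≤s (s≤s (m≤1+2⌊m/2⌋ m))

RedSubgraph : ∀ {n} → Colouring n → Graph n → Set
RedSubgraph c G = ∀ i j → col c i j ≡ true → col G i j ≡ true

RedBipartite : ∀ {n} → Colouring n → Vector Bool n → Set
RedBipartite c s = ∀ i j → col c i j ≡ true → Cut s i j ≡ true

half-cut-colouring : ∀ {n} (G : Graph n) →
  Σ (Vector Bool n) λ s → Σ (Colouring n) λ c →
    RedSubgraph c G × RedBipartite c s × countColour c true ≡ ⌊ edges G /2⌋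
half-cut-colouring {n} G =
  let s , large = large-cut n (col G)
      m = edges G
      cut-edges = count² (upper (col G ∩ Cut s))
      half-fits : ⌊ m /2⌋ ≤ cut-edges
      half-fits = ℕP.*-cancelˡ-≤ 2 (ℕP.≤-trans (2⌊m/2⌋≤m m)
                    (subst (_≤ 2 * cut-edges) (Eq.sym (edges-count² G)) large))
      V , V⊆ , #V = trim-matrix (upper (col G ∩ Cut s)) ⌊ m /2⌋ half-fits
      W-sym : ∀ i j → (col G ∩ Cut s) i j ≡ (col G ∩ Cut s) j i
      W-sym i j = cong₂ _∧_ (Defs.sym G i j) (xor-comm (s i) (s j))
      red-in-cut = selection-red-⊆ V (col G ∩ Cut s) V⊆ W-sym
  in s , selection-colouring V
     , (λ i j → ∧-conicalˡ _ _ ∘ red-in-cut i j)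
     , (λ i j → ∧-conicalʳ _ _ ∘ red-in-cut i j)
     , trans (selection-red-count V (col G ∩ Cut s) V⊆) #V

red-bound : ∀ {n} (G : Graph n) (c : Colouring n) → countColour c true ≡ ⌊ edges G /2⌋ →
            edges G ≤ suc (2 * countColour c true)
red-bound G c red≡ = subst (λ r → edges G ≤ suc (2 * r)) (Eq.sym red≡) (m≤1+2⌊m/2⌋ (edges G))

blue-bound : ∀ {n} (G : Graph n) (c : Colouring n) → countColour c true ≡ ⌊ edges G /2⌋ →
             edges G ≤ 2 * countColour c false
blue-bound G c red≡ = +-cancelˡ-≤ m m (2 * blue) (begin
  m + m                      ≡⟨ x+x≡2x m ⟩
  2 * m                      ≤⟨ *-monoʳ-≤ 2 (m≤m+n m (countColour G false)) ⟩
  2 * (m + countColour G false)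
                             ≡⟨ cong (2 *_) pairs ⟩
  2 * (⌊ m /2⌋ + blue)       ≡⟨ *-distribˡ-+ 2 ⌊ m /2⌋ blue ⟩
  2 * ⌊ m /2⌋ + 2 * blue     ≤⟨ +-monoˡ-≤ (2 * blue) (2⌊m/2⌋≤m m) ⟩
  m + 2 * blue               ∎)
  where
  open ≤-Reasoning
  m    = edges G
  blue = countColour c false
  -- Both colourings split the same set of pairs.
  pairs : m + countColour G false ≡ ⌊ m /2⌋ + blue
  pairs = trans (colour-classes-partition G)
            (trans (Eq.sym (colour-classes-partition c)) (cong (_+ blue) red≡))

no-odd-triangle : ∀ a b c → (a xor b) ≡ true → (b xor c) ≡ true → (a xor c) ≡ true → ⊥
no-odd-triangle true  true  _     ()
no-odd-triangle true  false true  _  _  ()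
no-odd-triangle true  false false _  () _
no-odd-triangle false true  true  _  () _
no-odd-triangle false true  false _  _  ()
no-odd-triangle false false _     ()

no-red-triangle : ∀ {n t} (c : Colouring n) (s : Vector Bool n)
                  {P : Fin t ⊎ Fin t → Fin t ⊎ Fin t → Bool} →
                  RedBipartite c s → InducesPattern c P →
                  ∀ x y z → x ≢ y → y ≢ z → x ≢ z →
                  P x y ≡ true → P y z ≡ true → P x z ≡ true → ⊥
no-red-triangle c s red-crosses (g , _ , induced) x y z x≢y y≢z x≢z Pxy Pyz Pxz =
  no-odd-triangle (s (g x)) (s (g y)) (s (g z))
    (crosses x y x≢y Pxy) (crosses y z y≢z Pyz) (crosses x z x≢z Pxz)
  where
  crosses : ∀ u v → u ≢ v → _ ≡ true → Cut s (g u) (g v) ≡ true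
  crosses u v u≢v Puv = red-crosses (g u) (g v) (trans (induced u v u≢v) Puv)

-- Red cliques contain red triangles (t ≥ 3), and two blue t-cliques are
-- joined by a red, hence G-, copy of K_{t,t}.
-- The patterns, by colour χ of their cliques: χ = red, one or two cliques: the
-- left clique; χ = blue, one clique: the right part, a red clique; χ = blue,
-- two cliques: the red left-right edges.
no-unavoidable : ∀ t {n} (c : Colouring n) (G : Graph n) (s : Vector Bool n) →
                 RedSubgraph c G → RedBipartite c s →
                 ¬ ContainsKtt (3 + t) G → ¬ ContainsUnavoidable (3 + t) c
no-unavoidable t c G s _ bipartite _ (true , inj₁ induces) =
  no-red-triangle c s bipartite induces (inj₁ 0F) (inj₁ 1F) (inj₁ 2F)
    (λ ()) (λ ()) (λ ()) refl refl refl
no-unavoidable t c G s _ bipartite _ (true , inj₂ induces) =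
  no-red-triangle c s bipartite induces (inj₁ 0F) (inj₁ 1F) (inj₁ 2F)
    (λ ()) (λ ()) (λ ()) refl refl refl
no-unavoidable t c G s _ bipartite _ (false , inj₁ induces) =
  no-red-triangle c s bipartite induces (inj₂ 0F) (inj₂ 1F) (inj₂ 2F)
    (λ ()) (λ ()) (λ ()) refl refl refl
no-unavoidable t c G s red⊆G _ Ktt-free (false , inj₂ (g , g-inj , induced)) =
  Ktt-free (g , g-inj , λ a b → red⊆G _ _ (induced (inj₁ a) (inj₂ b) (λ ())))

delta-bound : ∀ n' m k → m ≤ suc (2 * k) →
              deltaEx (suc n') m ℚ.* ((⁺ (suc n' * suc n')) ℚ./ 1) ℚ.≤ ((⁺ k) ℚ./ 1)
delta-bound n' m k m≤ =
  toℚᵘ-cancel-≤ (≤-respˡ-≃ (≃-sym lhs≃)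
                  (≤-respʳ-≃ (≃-sym (toℚᵘ-fromℚᵘ (mkℚᵘ (⁺ k) 0))) cross-multiplied))
  where
  N = suc n' * suc n'
  m-1 : ℤ
  m-1 = (⁺ m) ℤ.- (⁺ 1)
  δ = mkℚᵘ m-1 (ℕ.pred (2 * N))
  lhs≃ : toℚᵘ (deltaEx (suc n') m ℚ.* ((⁺ N) ℚ./ 1)) ℚᵘ.≃ (δ ℚᵘ.* mkℚᵘ (⁺ N) 0)
  lhs≃ = ≃-trans (toℚᵘ-homo-* (deltaEx (suc n') m) ((⁺ N) ℚ./ 1))
                 (*-cong (toℚᵘ-fromℚᵘ δ) (toℚᵘ-fromℚᵘ (mkℚᵘ (⁺ N) 0)))
  m-1≤2k : ∀ m → m ≤ suc (2 * k) → (⁺ m) ℤ.- (⁺ 1) ℤ.≤ ⁺ (2 * k)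
  m-1≤2k zero    _       = ℤ.-≤+
  m-1≤2k (suc m) (s≤s m≤) = ℤ.+≤+ m≤
  cross-multiplied : (δ ℚᵘ.* mkℚᵘ (⁺ N) 0) ℚᵘ.≤ mkℚᵘ (⁺ k) 0
  cross-multiplied = *≤* (begin
     (m-1 ℤ.* ⁺ N) ℤ.* ⁺ 1       ≡⟨ ℤP.*-identityʳ _ ⟩
     m-1 ℤ.* ⁺ N                 ≤⟨ ℤP.*-monoʳ-≤-nonNeg (⁺ N) (m-1≤2k m m≤) ⟩
     ⁺ (2 * k) ℤ.* ⁺ N           ≡⟨ Eq.sym (ℤP.pos-* (2 * k) N) ⟩
     ⁺ (2 * k * N)               ≡⟨ cong (λ x → ⁺ (x * N)) (ℕP.*-comm 2 k) ⟩
     ⁺ (k * 2 * N)               ≡⟨ cong ⁺_ (ℕP.*-assoc k 2 N) ⟩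
     ⁺ (k * (2 * N))             ≡⟨ ℤP.pos-* k (2 * N) ⟩
     ⁺ k ℤ.* ⁺ (2 * N)           ≡⟨ cong (⁺ k ℤ.*_) (Eq.sym (ℤP.*-identityʳ _)) ⟩
     ⁺ k ℤ.* (⁺ (2 * N) ℤ.* ⁺ 1) ∎)
    where open ℤP.≤-Reasoning

half-cut-far : ∀ {n'} (G : Graph (suc n')) (c : Colouring (suc n')) →
               countColour c true ≡ ⌊ edges G /2⌋ →
               FarFromMonochromatic (deltaEx (suc n') (edges G)) c
half-cut-far {n'} G c red≡ true  =
  delta-bound n' (edges G) (countColour c true) (red-bound G c red≡)
half-cut-far {n'} G c red≡ false =
  delta-bound n' (edges G) (countColour c false) (m≤n⇒m≤1+n (blue-bound G c red≡))

proposition3p1 : ∀ (t : ℕ) → 3 ≤ t →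
    ∃ λ (N : ℕ) → ∀ (n : ℕ) → .{{_ : NonZero n}} → N ≤ n →
    ∀ (m : ℕ) → IsExKtt n t m →
    Σ (Colouring n) λ c →
    ¬ ContainsUnavoidable t c × FarFromMonochromatic (deltaEx n m) c
proposition3p1 zero ()
proposition3p1 (suc zero) (s≤s ())
proposition3p1 (suc (suc zero)) (s≤s (s≤s ()))
proposition3p1 (suc (suc (suc t))) _ = 0 , half-cut-of-extremal
  where
  half-cut-of-extremal : ∀ (n : ℕ) → .{{_ : NonZero n}} → 0 ≤ n →
    ∀ (m : ℕ) → IsExKtt n (3 + t) m →
    Σ (Colouring n) λ c → ¬ ContainsUnavoidable (3 + t) c × FarFromMonochromatic (deltaEx n m) c
  half-cut-of-extremal zero {{n≢0}} _ _ _ with () ← ℕ.≢-nonZero⁻¹ 0 {{n≢0}} refl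
  half-cut-of-extremal (suc n') _ _ ((G , Ktt-free , refl) , _) =
    let s , c , red⊆G , bipartite , red≡ = half-cut-colouring G
    in c , no-unavoidable t c G s red⊆G bipartite Ktt-free , half-cut-far G c red≡
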